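{- There exists a Heron triangle all three of whose side lengths are perfect squares (of positive integers) if and only if the Diophantine equation \[ q^4 = r^4 - \frac{4k}{k^2+1}\,r^2 + 1 \] has a non-trivial rational solution $(k,r,q)\in\mathbb{Q}^3$ with $0<k<1$ and $r\neq 0$.
   Context: A Heron triangle is a (non-degenerate) triangle whose three side lengths and whose area are all positive integers. For this equation, the trivial rational solutions are those with $r=0$ (which force $q=\pm 1$); a non-trivial solution is one that is not of this form. -}

module Defs where

open import Data.Nat as ℕ using (ℕ)
open import Data.Integer as ℤ using (ℤ; +_)
open import Data.Rational as ℚ using (ℚ; 0ℚ; 1ℚ; NonZero; NonNegative)
open import Data.Rational.Properties as ℚP
open import Data.Product using (Σ; ∃; _×_; _,_)
open import Data.Sum using (inj₁; inj₂)
open import Relation.Binary.PropositionalEquality using (_≡_)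

-- 16·Area² = (a+b+c)(-a+b+c)(a-b+c)(a+b-c)   (Heron's formula), over ℤ.
heronProduct : ℕ → ℕ → ℕ → ℤ
heronProduct a b c =
  (A ℤ.+ B ℤ.+ C) ℤ.* ((ℤ.- A) ℤ.+ B ℤ.+ C)
    ℤ.* (A ℤ.- B ℤ.+ C) ℤ.* (A ℤ.+ B ℤ.- C)
  where
    A = + a
    B = + b
    C = + c

HeronTriangle : ℕ → ℕ → ℕ → Set
HeronTriangle a b c =
  0 ℕ.< a × 0 ℕ.< b × 0 ℕ.< c ×
  a ℕ.< b ℕ.+ c × b ℕ.< a ℕ.+ c × c ℕ.< a ℕ.+ b ×
  Σ ℕ (λ area → 0 ℕ.< area ×
       + (16 ℕ.* (area ℕ.* area)) ≡ heronProduct a b c)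

PositiveSquare : ℕ → Set
PositiveSquare n = Σ ℕ (λ x → 0 ℕ.< x × n ≡ x ℕ.* x)

sq-nonNeg : ∀ k → NonNegative (k ℚ.* k)
sq-nonNeg k with ℚP.≤-total 0ℚ k
... | inj₁ 0≤k = let instance _ = ℚ.nonNegative 0≤k in nonNeg*nonNeg⇒nonNeg k k
... | inj₂ k≤0 = let instance _ = ℚ.nonPositive k≤0 in nonPos*nonPos⇒nonPos k k

sq+1-nonZero : ∀ k → NonZero (k ℚ.* k ℚ.+ 1ℚ)
sq+1-nonZero k =
  let instance _ = sq-nonNeg k
      instance _ = nonNeg+pos⇒pos (k ℚ.* k) 1ℚ
  in pos⇒nonZero (k ℚ.* k ℚ.+ 1ℚ)

_^2 : ℚ → ℚ
x ^2 = x ℚ.* x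

_^4 : ℚ → ℚ
x ^4 = (x ^2) ^2

coeff : ℚ → ℚ
coeff k = ((+ 4) ℚ./ 1 ℚ.* k) ℚ.÷ ((k ^2) ℚ.+ 1ℚ)
  where instance _ = sq+1-nonZero k

Equation : ℚ → ℚ → ℚ → Set
Equation k r q = q ^4 ≡ (r ^4) ℚ.- coeff k ℚ.* (r ^2) ℚ.+ 1ℚ

NonTrivial : ℚ → ℚ → ℚ → Set
NonTrivial k r q = ¬ (r ≡ 0ℚ)
  where open import Relation.Nullary using (¬_)

-- Write a = A², b = B², c = C² and let γ be the angle opposite c, chosen acute by taking
-- c ≤ a.  The law of cosines c² = a² + b² − 2ab cos γ, divided by b², reads
-- q⁴ = r⁴ − 2 cos γ · r² + 1 with r = A/B, q = C/B.  Heron's formula says that the area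
-- Δ = ½ ab sin γ, so (cos γ, sin γ) = ((a² + b² − c²)/2ab, 4Δ/2ab) is a rational point of
-- the unit circle, and its half-angle parameter k = tan(π/4 − γ/2) ∈ (0, 1) is rational with
-- 2 cos γ = 4k/(k² + 1).  Conversely, for k = M/n the triangle with sides (2sX)², (2sY)²,
-- (2sZ)², where s = M² + n² and X, Y, Z clear the denominators of r and q, has
-- sin γ = (n² − M²)/s, and the factor (2s)² makes its area 8s³X²Y²(n² − M²) integral.

module Submission where

open import Defs
open import Data.Nat using (ℕ)
open import Data.Rational using (ℚ; 0ℚ; 1ℚ; _<_)
open import Data.Product using (Σ; _×_)
open import Function.Bundles using (_⇔_)
open import Relation.Binary.PropositionalEquality using (_≢_)

open import Data.Product using (_,_)
open import Data.Sum using (inj₁; inj₂)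
open import Data.List using (_∷_; [])
open import Function.Bundles using (mk⇔; module Equivalence)
open import Relation.Binary.PropositionalEquality
  using (_≡_; refl; sym; trans; cong; cong₂; subst; subst₂; module ≡-Reasoning)
open import Relation.Nullary using (yes; no; contradiction)
import Data.Nat as ℕ
import Data.Nat.Properties as ℕ
import Data.Nat.Tactic.RingSolver as ℕ-Solver
import Data.Integer as ℤ
import Data.Integer.Properties as ℤ

SquareHeronTriangle : Set
SquareHeronTriangle = Σ ℕ λ a → Σ ℕ λ b → Σ ℕ λ c →
  HeronTriangle a b c × PositiveSquare a × PositiveSquare b × PositiveSquare c

RationalSolution : Set
RationalSolution = Σ ℚ λ k → Σ ℚ λ r → Σ ℚ λ q →
  Equation k r q × NonTrivial k r q × 0ℚ < k × k < 1ℚ × r ≢ 0ℚ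

P²+S²≡D²⇒S<D : ∀ {P S D} → 0 ℕ.< P → P ℕ.* P ℕ.+ S ℕ.* S ≡ D ℕ.* D → S ℕ.< D
P²+S²≡D²⇒S<D {P@(ℕ.suc _)} {S} {D} _ eq = ℕ.≰⇒> λ D≤S → ℕ.<-irrefl refl (begin-strict
  D ℕ.* D             ≤⟨ ℕ.*-mono-≤ D≤S D≤S ⟩
  S ℕ.* S             <⟨ ℕ.m<n+m (S ℕ.* S) ℕ.z<s ⟩
  P ℕ.* P ℕ.+ S ℕ.* S ≡⟨ eq ⟩
  D ℕ.* D             ∎)
  where open ℕ.≤-Reasoning

P²+S²≡D²⇒D<P+S : ∀ {P S D} → 0 ℕ.< P → 0 ℕ.< S → P ℕ.* P ℕ.+ S ℕ.* S ≡ D ℕ.* D → D ℕ.< P ℕ.+ S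
P²+S²≡D²⇒D<P+S {P@(ℕ.suc _)} {S@(ℕ.suc _)} {D} _ _ eq = ℕ.≰⇒> λ P+S≤D → ℕ.<-irrefl refl (begin-strict
  (P ℕ.+ S) ℕ.* (P ℕ.+ S)               ≤⟨ ℕ.*-mono-≤ P+S≤D P+S≤D ⟩
  D ℕ.* D                               ≡⟨ sym eq ⟩
  P ℕ.* P ℕ.+ S ℕ.* S                   <⟨ ℕ.m<m+n (P ℕ.* P ℕ.+ S ℕ.* S) ℕ.z<s ⟩
  P ℕ.* P ℕ.+ S ℕ.* S ℕ.+ 2 ℕ.* P ℕ.* S ≡⟨ square-of-sum P S ⟩
  (P ℕ.+ S) ℕ.* (P ℕ.+ S)               ∎)
  where
  open ℕ.≤-Reasoning
  square-of-sum : ∀ P S → P ℕ.* P ℕ.+ S ℕ.* S ℕ.+ 2 ℕ.* P ℕ.* S ≡ (P ℕ.+ S) ℕ.* (P ℕ.+ S)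
  square-of-sum = ℕ-Solver.solve-∀

module HeronTriangles where
  open import Data.Integer.Base hiding (_<_)
  open import Data.Integer.Tactic.RingSolver using (solve-∀; solve)

  pos-∸ : ∀ {m n} → n ℕ.≤ m → + (m ℕ.∸ n) ≡ + m - + n
  pos-∸ {m} {n} n≤m = trans (sym (ℤ.⊖-≥ n≤m)) (sym (ℤ.m-n≡m⊖n m n))

  +[∣i∣*∣i∣]≡i*i : ∀ i → + (∣ i ∣ ℕ.* ∣ i ∣) ≡ i * i
  +[∣i∣*∣i∣]≡i*i (+ n)    = ℤ.pos-* n n
  +[∣i∣*∣i∣]≡i*i -[1+ n ] = refl

  *-nonZero : ∀ i j → NonZero i → NonZero j → NonZero (i * j)
  *-nonZero i j i≢0 j≢0 = ℤ.i*j≢0 i j {{i≢0}} {{j≢0}}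

  nonZero⇒0<∣i∣ : ∀ i → NonZero i → 0 ℕ.< ∣ i ∣
  nonZero⇒0<∣i∣ i i≢0 = ℕ.>-nonZero⁻¹ ∣ i ∣ {{i≢0}}

  -- heronProduct a b c is heron (+ a) (+ b) (+ c) by definition; INLINE lets the ring
  -- solver see through heron.
  heron : ℤ → ℤ → ℤ → ℤ
  heron a b c = (a + b + c) * (- a + b + c) * (a - b + c) * (a + b - c)
  {-# INLINE heron #-}

  -- The law of cosines c² = a² + b² − 2ab cos γ with cos γ = 2Mn/(M² + n²).
  CosineLaw : ℤ → ℤ → ℤ → ℤ → ℤ → Set
  CosineLaw M n a b c = (M * M + n * n) * (a * a + b * b - c * c) ≡ + 4 * M * n * (a * b)

  heron-swap₁₂ : ∀ a b c → heron a b c ≡ heron b a c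
  heron-swap₁₂ = solve-∀

  heron-swap₁₃ : ∀ a b c → heron a b c ≡ heron c b a
  heron-swap₁₃ = solve-∀

  heron-pythagorean : ∀ a b c →
    (a * a + b * b - c * c) * (a * a + b * b - c * c) + heron a b c ≡ (+ 2 * a * b) * (+ 2 * a * b)
  heron-pythagorean = solve-∀

  heron[b+c+d,b,c]≤0 : ∀ b c d → heron (+ (b ℕ.+ c ℕ.+ d)) (+ b) (+ c) ≤ 0ℤ
  heron[b+c+d,b,c]≤0 b c d = begin
    heron (+ b + + c + + d) (+ b) (+ c) ≡⟨ factorise (+ b) (+ c) (+ d) ⟩
    - (+ x * + d * + y * + z)           ≡⟨ cong -_ (sym pos-*³) ⟩
    - + (x ℕ.* d ℕ.* y ℕ.* z)           ≤⟨ ℤ.neg-≤-pos ⟩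
    0ℤ                                  ∎
    where
    open ℤ.≤-Reasoning
    x = b ℕ.+ b ℕ.+ c ℕ.+ c ℕ.+ d
    y = c ℕ.+ c ℕ.+ d
    z = b ℕ.+ b ℕ.+ d
    factorise : ∀ b c d → heron (b + c + d) b c ≡ - ((b + b + c + c + d) * d * (c + c + d) * (b + b + d))
    factorise = solve-∀
    pos-*³ : + (x ℕ.* d ℕ.* y ℕ.* z) ≡ + x * + d * + y * + z
    pos-*³ = trans (ℤ.pos-* (x ℕ.* d ℕ.* y) z)
                   (cong (_* + z) (trans (ℤ.pos-* (x ℕ.* d) y) (cong (_* + y) (ℤ.pos-* x d))))

  0<heron⇒a<b+c : ∀ {a b c} → 0ℤ ℤ.< heron (+ a) (+ b) (+ c) → a ℕ.< b ℕ.+ c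
  0<heron⇒a<b+c {a} {b} {c} 0<heron with a ℕ.<? b ℕ.+ c
  ... | yes a<b+c = a<b+c
  ... | no  a≮b+c = contradiction (subst (λ x → heron (+ x) (+ b) (+ c) ≤ 0ℤ) b+c+d≡a (heron[b+c+d,b,c]≤0 b c _))
                                  (ℤ.<⇒≱ 0<heron)
    where b+c+d≡a = ℕ.m+[n∸m]≡n (ℕ.≮⇒≥ a≮b+c)

  a<b+c⇒b<a+c⇒0<c : ∀ {a b c} → a ℕ.< b ℕ.+ c → b ℕ.< a ℕ.+ c → 0 ℕ.< c
  a<b+c⇒b<a+c⇒0<c {a} {b} {ℕ.zero} a<b+0 b<a+0 =
    contradiction (subst (b ℕ.<_) (ℕ.+-identityʳ a) b<a+0) (ℕ.<-asym (subst (a ℕ.<_) (ℕ.+-identityʳ b) a<b+0))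
  a<b+c⇒b<a+c⇒0<c {c = ℕ.suc _} _ _ = ℕ.z<s

  heronTriangle : ∀ {a b c} Δ → 0 ℕ.< a → 0 ℕ.< b → 0 ℕ.< Δ →
                  + (16 ℕ.* (Δ ℕ.* Δ)) ≡ heronProduct a b c → HeronTriangle a b c
  heronTriangle {a} {b} {c} Δ@(ℕ.suc _) 0<a 0<b 0<Δ 16Δ²≡heron =
    0<a , 0<b , a<b+c⇒b<a+c⇒0<c a<b+c b<a+c , a<b+c , b<a+c , c<a+b , Δ , 0<Δ , 16Δ²≡heron
    where
    0<heron : 0ℤ ℤ.< heron (+ a) (+ b) (+ c)
    0<heron = subst (0ℤ ℤ.<_) 16Δ²≡heron (ℤ.+<+ ℕ.z<s)
    a<b+c = 0<heron⇒a<b+c 0<heron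
    b<a+c = 0<heron⇒a<b+c (subst (0ℤ ℤ.<_) (heron-swap₁₂ (+ a) (+ b) (+ c)) 0<heron)
    c<a+b = subst (c ℕ.<_) (ℕ.+-comm b a)
                  (0<heron⇒a<b+c (subst (0ℤ ℤ.<_) (heron-swap₁₃ (+ a) (+ b) (+ c)) 0<heron))

  squareHeronTriangle : ∀ u v w t → NonZero u → NonZero v → NonZero t →
                        heron (u * u) (v * v) (w * w) ≡ + 16 * (t * t) → SquareHeronTriangle
  squareHeronTriangle u v w t u≢0 v≢0 t≢0 heron≡16t² =
    side u , side v , side w , triangle , square u u≢0 , square v v≢0 , (∣ w ∣ , 0<∣w∣ , refl)
    where
    side : ℤ → ℕ
    side i = ∣ i ∣ ℕ.* ∣ i ∣

    square : ∀ i → NonZero i → PositiveSquare (side i)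
    square i i≢0 = ∣ i ∣ , nonZero⇒0<∣i∣ i i≢0 , refl

    0<side : ∀ i → NonZero i → 0 ℕ.< side i
    0<side i i≢0 = ℕ.>-nonZero⁻¹ (side i) {{ℕ.m*n≢0 ∣ i ∣ ∣ i ∣ {{i≢0}} {{i≢0}}}}

    16Δ²≡heron : + (16 ℕ.* (∣ t ∣ ℕ.* ∣ t ∣)) ≡ heronProduct (side u) (side v) (side w)
    16Δ²≡heron = begin
      + (16 ℕ.* (∣ t ∣ ℕ.* ∣ t ∣))
        ≡⟨ trans (ℤ.pos-* 16 (side t)) (cong (+ 16 *_) (+[∣i∣*∣i∣]≡i*i t)) ⟩
      + 16 * (t * t)
        ≡⟨ sym heron≡16t² ⟩
      heron (u * u) (v * v) (w * w)
        ≡⟨ sym (cong₂ (λ a b → heron a b (w * w)) (+[∣i∣*∣i∣]≡i*i u) (+[∣i∣*∣i∣]≡i*i v)) ⟩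
      heron (+ side u) (+ side v) (w * w)
        ≡⟨ sym (cong (heron (+ side u) (+ side v)) (+[∣i∣*∣i∣]≡i*i w)) ⟩
      heron (+ side u) (+ side v) (+ side w) ∎
      where open ≡-Reasoning

    triangle : HeronTriangle (side u) (side v) (side w)
    triangle = heronTriangle ∣ t ∣ (0<side u u≢0) (0<side v v≢0) (nonZero⇒0<∣i∣ t t≢0) 16Δ²≡heron

    0<∣w∣ : 0 ℕ.< ∣ w ∣
    0<∣w∣ = let _ , _ , 0<side-w , _ = triangle in
      ℕ.>-nonZero⁻¹ ∣ w ∣ {{ℕ.m*n≢0⇒m≢0 ∣ w ∣ {{ℕ.>-nonZero 0<side-w}}}}

  -- With 16Δ² = S², the quotient (2ab − S)/(a² + b² − c²) is tan(π/4 − γ/2).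
  heron≡S²⇒cosineLaw : ∀ a b c S → heron a b c ≡ S * S →
                       CosineLaw (+ 2 * a * b - S) (a * a + b * b - c * c) a b c
  heron≡S²⇒cosineLaw a b c S heron≡S² =
    let E = + 2 * a * b - S
        T = a * a + b * b - c * c
    in begin
    (E * E + T * T) * T
      ≡⟨ solve (a ∷ b ∷ c ∷ S ∷ []) ⟩
    + 4 * E * T * (a * b) + T * (S * S - heron a b c)
      ≡⟨ cong (λ h → + 4 * E * T * (a * b) + T * (S * S - h)) heron≡S² ⟩
    + 4 * E * T * (a * b) + T * (S * S - S * S)
      ≡⟨ solve (a ∷ b ∷ c ∷ S ∷ []) ⟩
    + 4 * E * T * (a * b) ∎
    where open ≡-Reasoning

  -- 16Δ² = (2ab sin γ)² with sin γ = (n² − M²)/(M² + n²).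
  cosineLaw⇒heron : ∀ M n a b c → CosineLaw M n a b c →
                    (M * M + n * n) * (M * M + n * n) * heron a b c
                      ≡ (+ 2 * a * b * ((n - M) * (n + M))) * (+ 2 * a * b * ((n - M) * (n + M)))
  cosineLaw⇒heron M n a b c law =
    let s = M * M + n * n
        T = a * a + b * b - c * c
        u = + 2 * a * b * ((n - M) * (n + M))
        v = + 4 * M * n * (a * b)
    in begin
    s * s * heron a b c               ≡⟨ solve (M ∷ n ∷ a ∷ b ∷ c ∷ []) ⟩
    u * u + (v - s * T) * (v + s * T) ≡⟨ cong (λ x → u * u + (v - x) * (v + x)) law ⟩
    u * u + (v - v) * (v + v)         ≡⟨ solve (M ∷ n ∷ a ∷ b ∷ []) ⟩
    u * u                             ∎
    where open ≡-Reasoning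

  heron-scale : ∀ s u a b c → s * s * heron a b c ≡ u * u →
                heron (+ 4 * (s * s) * a) (+ 4 * (s * s) * b) (+ 4 * (s * s) * c)
                  ≡ + 16 * ((+ 4 * (s * s * s) * u) * (+ 4 * (s * s * s) * u))
  heron-scale s u a b c s²heron≡u² = begin
    heron (+ 4 * (s * s) * a) (+ 4 * (s * s) * b) (+ 4 * (s * s) * c)
      ≡⟨ solve (s ∷ a ∷ b ∷ c ∷ []) ⟩
    + 256 * (s * s * s) * (s * s * s) * (s * s * heron a b c)
      ≡⟨ cong (+ 256 * (s * s * s) * (s * s * s) *_) s²heron≡u² ⟩
    + 256 * (s * s * s) * (s * s * s) * (u * u)
      ≡⟨ solve (s ∷ u ∷ []) ⟩
    + 16 * ((+ 4 * (s * s * s) * u) * (+ 4 * (s * s * s) * u)) ∎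
    where open ≡-Reasoning

  cosineLaw⇒squareHeronTriangle : ∀ M n X Y Z → 0 ℕ.< M → M ℕ.< n → NonZero X → NonZero Y →
                                  CosineLaw (+ M) (+ n) (X * X) (Y * Y) (Z * Z) → SquareHeronTriangle
  cosineLaw⇒squareHeronTriangle M@(ℕ.suc _) n@(ℕ.suc _) X Y Z _ M<n X≢0 Y≢0 law =
    squareHeronTriangle (u X) (u Y) (u Z) t (u≢0 X X≢0) (u≢0 Y Y≢0) t≢0 heron≡16t²
    where
    s = + M * + M + + n * + n
    d = (+ n - + M) * (+ n + + M)
    v = + 2 * (X * X) * (Y * Y) * d
    t = + 4 * (s * s * s) * v

    u : ℤ → ℤ
    u W = + 2 * s * W

    -- M and n are successors, so s normalises to a positive constructor form and the
    -- NonZero arguments written _ below are trivial.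
    u≢0 : ∀ W → NonZero W → NonZero (u W)
    u≢0 W W≢0 = *-nonZero (+ 2 * s) W _ W≢0

    t≢0 : NonZero t
    t≢0 = *-nonZero (+ 4 * (s * s * s)) v _
            (*-nonZero (+ 2 * (X * X) * (Y * Y)) d
              (*-nonZero (+ 2 * (X * X)) (Y * Y) (*-nonZero (+ 2) (X * X) _ (*-nonZero X X X≢0 X≢0))
                                                 (*-nonZero Y Y Y≢0 Y≢0))
              (*-nonZero (+ n - + M) (+ n + + M)
                (subst NonZero (pos-∸ (ℕ.<⇒≤ M<n)) (ℕ.>-nonZero (ℕ.m<n⇒0<n∸m M<n))) _))

    u²≡4s²W² : ∀ W → u W * u W ≡ + 4 * (s * s) * (W * W)
    u²≡4s²W² W = [2sW]²≡4s²W² s W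
      where
      [2sW]²≡4s²W² : ∀ s W → (+ 2 * s * W) * (+ 2 * s * W) ≡ + 4 * (s * s) * (W * W)
      [2sW]²≡4s²W² = solve-∀

    heron≡16t² : heron (u X * u X) (u Y * u Y) (u Z * u Z) ≡ + 16 * (t * t)
    heron≡16t² = begin
      heron (u X * u X) (u Y * u Y) (u Z * u Z)
        ≡⟨ cong₂ (λ a b → heron a b (u Z * u Z)) (u²≡4s²W² X) (u²≡4s²W² Y) ⟩
      heron (+ 4 * (s * s) * (X * X)) (+ 4 * (s * s) * (Y * Y)) (u Z * u Z)
        ≡⟨ cong (heron (+ 4 * (s * s) * (X * X)) (+ 4 * (s * s) * (Y * Y))) (u²≡4s²W² Z) ⟩
      heron (+ 4 * (s * s) * (X * X)) (+ 4 * (s * s) * (Y * Y)) (+ 4 * (s * s) * (Z * Z))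
        ≡⟨ heron-scale s v (X * X) (Y * Y) (Z * Z) (cosineLaw⇒heron (+ M) (+ n) (X * X) (Y * Y) (Z * Z) law) ⟩
      + 16 * (t * t) ∎
      where open ≡-Reasoning

  +[a²+b²∸c²]≡a²+b²-c² : ∀ a b c → c ℕ.≤ a →
                          + (a ℕ.* a ℕ.+ b ℕ.* b ℕ.∸ c ℕ.* c) ≡ + a * + a + + b * + b - + c * + c
  +[a²+b²∸c²]≡a²+b²-c² a b c c≤a =
    trans (pos-∸ (ℕ.≤-trans (ℕ.*-mono-≤ c≤a c≤a) (ℕ.m≤m+n (a ℕ.* a) (b ℕ.* b))))
          (cong₂ _-_ (cong₂ _+_ (ℤ.pos-* a a) (ℤ.pos-* b b)) (ℤ.pos-* c c))

  +[2*a*b]≡2ab : ∀ a b → + (2 ℕ.* a ℕ.* b) ≡ + 2 * + a * + b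
  +[2*a*b]≡2ab a b = trans (ℤ.pos-* (2 ℕ.* a) b) (cong (_* + b) (ℤ.pos-* 2 a))

  heron≡S²⇒P²+S²≡D² : ∀ a b c S → c ℕ.≤ a → heron (+ a) (+ b) (+ c) ≡ + S * + S →
                      let P = a ℕ.* a ℕ.+ b ℕ.* b ℕ.∸ c ℕ.* c
                          D = 2 ℕ.* a ℕ.* b
                      in P ℕ.* P ℕ.+ S ℕ.* S ≡ D ℕ.* D
  heron≡S²⇒P²+S²≡D² a b c S c≤a heron≡S² = ℤ.+-injective (begin
    + (P ℕ.* P) + + (S ℕ.* S)
      ≡⟨ cong₂ _+_ (ℤ.pos-* P P) (ℤ.pos-* S S) ⟩
    + P * + P + + S * + S
      ≡⟨ cong₂ (λ x y → x * x + y) (+[a²+b²∸c²]≡a²+b²-c² a b c c≤a) (sym heron≡S²) ⟩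
    (+ a * + a + + b * + b - + c * + c) * (+ a * + a + + b * + b - + c * + c) + heron (+ a) (+ b) (+ c)
      ≡⟨ heron-pythagorean (+ a) (+ b) (+ c) ⟩
    (+ 2 * + a * + b) * (+ 2 * + a * + b)
      ≡⟨ sym (trans (ℤ.pos-* D D) (cong₂ _*_ (+[2*a*b]≡2ab a b) (+[2*a*b]≡2ab a b))) ⟩
    + (D ℕ.* D) ∎)
    where
    open ≡-Reasoning
    P = a ℕ.* a ℕ.+ b ℕ.* b ℕ.∸ c ℕ.* c
    D = 2 ℕ.* a ℕ.* b

  heron⇒cosineLaw : ∀ {a b c} Δ → 0 ℕ.< b → 0 ℕ.< Δ → c ℕ.≤ a →
                    + (16 ℕ.* (Δ ℕ.* Δ)) ≡ heron (+ a) (+ b) (+ c) →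
                    Σ ℕ λ e → Σ ℕ λ P → 0 ℕ.< e × e ℕ.< P × CosineLaw (+ e) (+ P) (+ a) (+ b) (+ c)
  heron⇒cosineLaw {a} {b@(ℕ.suc _)} {c} Δ@(ℕ.suc _) _ _ c≤a 16Δ²≡heron =
    D ℕ.∸ S , P , ℕ.m<n⇒0<n∸m S<D , D∸S<P , law
    where
    P = a ℕ.* a ℕ.+ b ℕ.* b ℕ.∸ c ℕ.* c
    S = 4 ℕ.* Δ
    D = 2 ℕ.* a ℕ.* b

    0<P : 0 ℕ.< P
    0<P = ℕ.<-≤-trans ℕ.z<s (subst (b ℕ.* b ℕ.≤_) (sym (ℕ.+-∸-comm (b ℕ.* b) (ℕ.*-mono-≤ c≤a c≤a)))
                                    (ℕ.m≤n+m (b ℕ.* b) (a ℕ.* a ℕ.∸ c ℕ.* c)))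

    heron≡S² : heron (+ a) (+ b) (+ c) ≡ + S * + S
    heron≡S² = trans (sym 16Δ²≡heron) (trans (cong +_ (16x²≡[4x]² Δ)) (ℤ.pos-* S S))
      where
      16x²≡[4x]² : ∀ x → 16 ℕ.* (x ℕ.* x) ≡ 4 ℕ.* x ℕ.* (4 ℕ.* x)
      16x²≡[4x]² = ℕ-Solver.solve-∀

    P²+S²≡D² : P ℕ.* P ℕ.+ S ℕ.* S ≡ D ℕ.* D
    P²+S²≡D² = heron≡S²⇒P²+S²≡D² a b c S c≤a heron≡S²

    S<D : S ℕ.< D
    S<D = P²+S²≡D²⇒S<D 0<P P²+S²≡D²

    D∸S<P : D ℕ.∸ S ℕ.< P
    D∸S<P = ℕ.m<n+o⇒m∸n<o D S {{ℕ.>-nonZero 0<P}}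
              (subst (D ℕ.<_) (ℕ.+-comm P S) (P²+S²≡D²⇒D<P+S 0<P ℕ.z<s P²+S²≡D²))

    law : CosineLaw (+ (D ℕ.∸ S)) (+ P) (+ a) (+ b) (+ c)
    law = subst₂ (λ E T → CosineLaw E T (+ a) (+ b) (+ c))
                 (sym (trans (pos-∸ (ℕ.<⇒≤ S<D)) (cong (_- + S) (+[2*a*b]≡2ab a b))))
                 (sym (+[a²+b²∸c²]≡a²+b²-c² a b c c≤a))
                 (heron≡S²⇒cosineLaw (+ a) (+ b) (+ c) (+ S) heron≡S²)

open HeronTriangles

module QuarticEquation where
  open import Data.Rational.Base
  open import Data.Rational.Literals using (fromℤ)
  import Data.Rational.Properties as ℚ
  import Data.Rational.Unnormalised.Base as ℚᵘ
  open ℚᵘ using (mkℚᵘ)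
  import Data.Rational.Unnormalised.Properties as ℚᵘ
  open import Data.Rational.Solver using (module +-*-Solver)
  open +-*-Solver using (solve; _:=_; con; _:+_; _:-_; _:*_)
  open import Data.Integer.Base using (ℤ; +_; -[1+_])
  import Data.Integer.Tactic.RingSolver as ℤ-Solver
  open import Data.Vec.Base as Vec using (_∷_; [])
  open import Data.Vec.Properties using (lookup-map)
  open import Data.Fin using (#_)
  open import Function.Base using (id; _∘_)
  import Function.Properties.Equivalence as ⇔
  open import Tactic.RingSolver.Core.Expression using (Expr; Κ; Ι; _⊕_; _⊗_; _⊛_; ⊝_; module Eval)
  open import Algebra.Definitions.RawSemiring ℤ.+-*-rawSemiring using () renaming (_^′_ to _^ℤ_)
  open import Algebra.Definitions.RawSemiring +-*-rawSemiring using (_^′_)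

  fromℤ-+ : ∀ i j → fromℤ (i ℤ.+ j) ≡ fromℤ i + fromℤ j
  fromℤ-+ i j = trans (sym (ℚ.↥p/↧p≡p (fromℤ (i ℤ.+ j)))) (cong (_/ 1) (i+j≡i*1+j*1 i j))
    where
    i+j≡i*1+j*1 : ∀ i j → i ℤ.+ j ≡ i ℤ.* + 1 ℤ.+ j ℤ.* + 1
    i+j≡i*1+j*1 = ℤ-Solver.solve-∀

  -- fromℤ i * fromℤ j reduces to (i ℤ.* j) / 1.
  fromℤ-* : ∀ i j → fromℤ (i ℤ.* j) ≡ fromℤ i * fromℤ j
  fromℤ-* i j = sym (ℚ.↥p/↧p≡p (fromℤ (i ℤ.* j)))

  fromℤ-neg : ∀ i → fromℤ (ℤ.- i) ≡ - fromℤ i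
  fromℤ-neg (+ ℕ.zero)  = refl
  fromℤ-neg (+ ℕ.suc n) = refl
  fromℤ-neg -[1+ n ]    = refl

  fromℤ-^′ : ∀ i n → fromℤ (i ^ℤ n) ≡ fromℤ i ^′ n
  fromℤ-^′ i 0                 = refl
  fromℤ-^′ i 1                 = refl
  fromℤ-^′ i (ℕ.suc (ℕ.suc n)) = trans (fromℤ-* (i ^ℤ ℕ.suc n) i) (cong (_* fromℤ i) (fromℤ-^′ i (ℕ.suc n)))

  fromℤ-injective : ∀ {i j} → fromℤ i ≡ fromℤ j → i ≡ j
  fromℤ-injective = cong ↥_

  open Eval ℤ.+-*-rawRing id renaming (⟦_⟧ to ⟦_⟧ℤ)
  open Eval +-*-rawRing fromℤ renaming (⟦_⟧ to ⟦_⟧ℚ)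

  fromℤ-⟦⟧ : ∀ {m} (e : Expr ℤ m) ρ → fromℤ (⟦ e ⟧ℤ ρ) ≡ ⟦ e ⟧ℚ (Vec.map fromℤ ρ)
  fromℤ-⟦⟧ (Κ i)   ρ = refl
  fromℤ-⟦⟧ (Ι x)   ρ = sym (lookup-map x fromℤ ρ)
  fromℤ-⟦⟧ (e ⊕ f) ρ =
    trans (fromℤ-+ (⟦ e ⟧ℤ ρ) (⟦ f ⟧ℤ ρ)) (cong₂ _+_ (fromℤ-⟦⟧ e ρ) (fromℤ-⟦⟧ f ρ))
  fromℤ-⟦⟧ (e ⊗ f) ρ =
    trans (fromℤ-* (⟦ e ⟧ℤ ρ) (⟦ f ⟧ℤ ρ)) (cong₂ _*_ (fromℤ-⟦⟧ e ρ) (fromℤ-⟦⟧ f ρ))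
  fromℤ-⟦⟧ (e ⊛ n) ρ = trans (fromℤ-^′ (⟦ e ⟧ℤ ρ) n) (cong (_^′ n) (fromℤ-⟦⟧ e ρ))
  fromℤ-⟦⟧ (⊝ e)   ρ = trans (fromℤ-neg (⟦ e ⟧ℤ ρ)) (cong -_ (fromℤ-⟦⟧ e ρ))

  *-cancelˡ-≡ : ∀ c {x y} → c ≢ 0ℚ → c * x ≡ c * y → x ≡ y
  *-cancelˡ-≡ c {x} {y} c≢0 cx≡cy = begin
    x              ≡⟨ sym (1/c*[c*z]≡z x) ⟩
    1/ c * (c * x) ≡⟨ cong (1/ c *_) cx≡cy ⟩
    1/ c * (c * y) ≡⟨ 1/c*[c*z]≡z y ⟩
    y              ∎
    where
    open ≡-Reasoning
    instance _ = ≢-nonZero c≢0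
    1/c*[c*z]≡z : ∀ z → 1/ c * (c * z) ≡ z
    1/c*[c*z]≡z z = trans (sym (ℚ.*-assoc (1/ c) c z)) (trans (cong (_* z) (ℚ.*-inverseˡ c)) (ℚ.*-identityˡ z))

  p*q≢0 : ∀ {p q} → p ≢ 0ℚ → q ≢ 0ℚ → p * q ≢ 0ℚ
  p*q≢0 {p} p≢0 q≢0 pq≡0 = q≢0 (*-cancelˡ-≡ p p≢0 (trans pq≡0 (sym (ℚ.*-zeroʳ p))))

  i/n*n≡i : ∀ i n .{{_ : ℕ.NonZero n}} → i / n * fromℤ (+ n) ≡ fromℤ i
  i/n*n≡i i n@(ℕ.suc n-1) = ℚ.toℚᵘ-injective (begin
    toℚᵘ (i / n * fromℤ (+ n))         ≈⟨ ℚ.toℚᵘ-homo-* (i / n) (fromℤ (+ n)) ⟩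
    toℚᵘ (i / n) ℚᵘ.* mkℚᵘ (+ n) 0     ≈⟨ ℚᵘ.*-congʳ (ℚ.toℚᵘ-fromℚᵘ (mkℚᵘ i n-1)) ⟩
    mkℚᵘ i n-1 ℚᵘ.* mkℚᵘ (+ n) 0       ≈⟨ ℚᵘ.*≡* (i*n*1≡i*[n*1] i (+ n)) ⟩
    mkℚᵘ i 0                           ∎)
    where
    open ℚᵘ.≃-Reasoning
    i*n*1≡i*[n*1] : ∀ i n → i ℤ.* n ℤ.* + 1 ≡ i ℤ.* (n ℤ.* + 1)
    i*n*1≡i*[n*1] = ℤ-Solver.solve-∀

  m<n⇒+m/n<1 : ∀ {m n} .{{_ : ℕ.NonZero n}} → m ℕ.< n → + m / n < 1ℚ
  m<n⇒+m/n<1 {m} {n@(ℕ.suc n-1)} m<n =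
    ℚ.toℚᵘ-cancel-< (ℚᵘ.<-respˡ-≃ (ℚᵘ.≃-sym (ℚ.toℚᵘ-fromℚᵘ (mkℚᵘ (+ m) n-1)))
                       (ℚᵘ.*<* (subst₂ ℤ._<_ (sym (ℤ.*-identityʳ (+ m))) (sym (ℤ.*-identityˡ (+ n))) (ℤ.+<+ m<n))))

  p*↧p≡↥p : ∀ p → p * fromℤ (↧ p) ≡ fromℤ (↥ p)
  p*↧p≡↥p p = trans (cong (_* fromℤ (↧ p)) (sym (ℚ.↥p/↧p≡p p))) (i/n*n≡i (↥ p) (↧ₙ p))

  p*[↧p*i]≡↥p*i : ∀ p i → p * fromℤ (↧ p ℤ.* i) ≡ fromℤ (↥ p ℤ.* i)
  p*[↧p*i]≡↥p*i p i = begin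
    p * fromℤ (↧ p ℤ.* i)       ≡⟨ cong (p *_) (fromℤ-* (↧ p) i) ⟩
    p * (fromℤ (↧ p) * fromℤ i) ≡⟨ sym (ℚ.*-assoc p (fromℤ (↧ p)) (fromℤ i)) ⟩
    p * fromℤ (↧ p) * fromℤ i   ≡⟨ cong (_* fromℤ i) (p*↧p≡↥p p) ⟩
    fromℤ (↥ p) * fromℤ i       ≡⟨ sym (fromℤ-* (↥ p) i) ⟩
    fromℤ (↥ p ℤ.* i)           ∎
    where open ≡-Reasoning

  equation⇔cleared : ∀ k r q → Equation k r q ⇔
                     (k * k + 1ℚ) * (r * r * (r * r) + 1ℚ - q * q * (q * q)) ≡ fromℤ (+ 4) * k * (r * r)
  equation⇔cleared k r q = mk⇔ to from
    where
    open ≡-Reasoning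
    instance _ = sq+1-nonZero k
    w = k * k + 1ℚ
    R = r * r * (r * r)
    Q = q * q * (q * q)
    F = fromℤ (+ 4) * k

    to : Equation k r q → w * (R + 1ℚ - Q) ≡ F * (r * r)
    to eq = begin
      w * (R + 1ℚ - Q)                             ≡⟨ cong (λ x → w * (R + 1ℚ - x)) eq ⟩
      w * (R + 1ℚ - (R - F * 1/ w * (r * r) + 1ℚ))
        ≡⟨ solve 5 (λ w u F R S → w :* (R :+ con 1ℚ :- (R :- F :* u :* S :+ con 1ℚ)) := w :* u :* (F :* S))
                   refl w (1/ w) F R (r * r) ⟩
      w * 1/ w * (F * (r * r))
        ≡⟨ cong (_* (F * (r * r))) (ℚ.*-inverseʳ w) ⟩
      1ℚ * (F * (r * r))
        ≡⟨ ℚ.*-identityˡ (F * (r * r)) ⟩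
      F * (r * r) ∎

    from : w * (R + 1ℚ - Q) ≡ F * (r * r) → Equation k r q
    from eq = sym (begin
      R - F * 1/ w * (r * r) + 1ℚ
        ≡⟨ solve 4 (λ u F R S → R :- F :* u :* S :+ con 1ℚ := R :+ con 1ℚ :- u :* (F :* S)) refl (1/ w) F R (r * r) ⟩
      R + 1ℚ - 1/ w * (F * (r * r))
        ≡⟨ cong (λ x → R + 1ℚ - 1/ w * x) (sym eq) ⟩
      R + 1ℚ - 1/ w * (w * (R + 1ℚ - Q))
        ≡⟨ cong (λ x → R + 1ℚ - x) (sym (ℚ.*-assoc (1/ w) w (R + 1ℚ - Q))) ⟩
      R + 1ℚ - 1/ w * w * (R + 1ℚ - Q)
        ≡⟨ cong (λ x → R + 1ℚ - x * (R + 1ℚ - Q)) (ℚ.*-inverseˡ w) ⟩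
      R + 1ℚ - 1ℚ * (R + 1ℚ - Q)
        ≡⟨ solve 2 (λ R Q → R :+ con 1ℚ :- con 1ℚ :* (R :+ con 1ℚ :- Q) := Q) refl R Q ⟩
      Q ∎)

  -- Evaluated in ℤ at M ∷ n ∷ X ∷ Y ∷ Z ∷ [], these are by definition the two sides of
  -- CosineLaw M n (X * X) (Y * Y) (Z * Z).
  cosineLawˡ cosineLawʳ : Expr ℤ 5
  cosineLawˡ = (m ⊗ m ⊕ n ⊗ n) ⊗ (x ⊗ x ⊗ (x ⊗ x) ⊕ y ⊗ y ⊗ (y ⊗ y) ⊕ ⊝ (z ⊗ z ⊗ (z ⊗ z)))
    where m = Ι (# 0); n = Ι (# 1); x = Ι (# 2); y = Ι (# 3); z = Ι (# 4)
  cosineLawʳ = Κ (+ 4) ⊗ m ⊗ n ⊗ (x ⊗ x ⊗ (y ⊗ y))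
    where m = Ι (# 0); n = Ι (# 1); x = Ι (# 2); y = Ι (# 3)

  equation⇔cosineLaw : ∀ k r q M n X Y Z → n ≢ + 0 → Y ≢ + 0 →
                       k * fromℤ n ≡ fromℤ M → r * fromℤ Y ≡ fromℤ X → q * fromℤ Y ≡ fromℤ Z →
                       Equation k r q ⇔ CosineLaw M n (X ℤ.* X) (Y ℤ.* Y) (Z ℤ.* Z)
  equation⇔cosineLaw k r q M n X Y Z n≢0 Y≢0 kn≡M rY≡X qY≡Z =
    ⇔.trans (equation⇔cleared k r q)
   (⇔.trans (mk⇔ (cong (N *_)) (*-cancelˡ-≡ N N≢0))
   (⇔.trans (mk⇔ (λ eq → trans (sym lhs≡) (trans eq rhs≡)) (λ eq → trans lhs≡ (trans eq (sym rhs≡))))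
            (mk⇔ fromℤ-injective (cong fromℤ))))
    where
    open ≡-Reasoning
    -- N = (n Y²)² clears the denominators n of k and Y of r and q.
    u = fromℤ n * (fromℤ Y * fromℤ Y)
    N = u * u
    N≢0 : N ≢ 0ℚ
    N≢0 = let u≢0 = p*q≢0 (n≢0 ∘ fromℤ-injective) (p*q≢0 (Y≢0 ∘ fromℤ-injective) (Y≢0 ∘ fromℤ-injective))
          in p*q≢0 u≢0 u≢0

    ρ = M ∷ n ∷ X ∷ Y ∷ Z ∷ []
    ρ≡ : k * fromℤ n ∷ fromℤ n ∷ r * fromℤ Y ∷ fromℤ Y ∷ q * fromℤ Y ∷ [] ≡ Vec.map fromℤ ρ
    ρ≡ = cong₂ _∷_ kn≡M (cong (fromℤ n ∷_) (cong₂ _∷_ rY≡X (cong (fromℤ Y ∷_) (cong₂ _∷_ qY≡Z refl))))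

    lhs≡ : N * ((k * k + 1ℚ) * (r * r * (r * r) + 1ℚ - q * q * (q * q))) ≡ fromℤ (⟦ cosineLawˡ ⟧ℤ ρ)
    lhs≡ = begin
      N * ((k * k + 1ℚ) * (r * r * (r * r) + 1ℚ - q * q * (q * q)))
        ≡⟨ solve 5 (λ k r q n Y → let nY² = n :* (Y :* Y); kn = k :* n; rY = r :* Y; qY = q :* Y in
                     nY² :* nY² :* ((k :* k :+ con 1ℚ) :* (r :* r :* (r :* r) :+ con 1ℚ :- q :* q :* (q :* q)))
                     := (kn :* kn :+ n :* n) :* (rY :* rY :* (rY :* rY) :+ Y :* Y :* (Y :* Y) :- qY :* qY :* (qY :* qY)))
                   refl k r q (fromℤ n) (fromℤ Y) ⟩
      ⟦ cosineLawˡ ⟧ℚ (k * fromℤ n ∷ fromℤ n ∷ r * fromℤ Y ∷ fromℤ Y ∷ q * fromℤ Y ∷ [])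
        ≡⟨ cong ⟦ cosineLawˡ ⟧ℚ ρ≡ ⟩
      ⟦ cosineLawˡ ⟧ℚ (Vec.map fromℤ ρ)
        ≡⟨ sym (fromℤ-⟦⟧ cosineLawˡ ρ) ⟩
      fromℤ (⟦ cosineLawˡ ⟧ℤ ρ) ∎

    rhs≡ : N * (fromℤ (+ 4) * k * (r * r)) ≡ fromℤ (⟦ cosineLawʳ ⟧ℤ ρ)
    rhs≡ = begin
      N * (fromℤ (+ 4) * k * (r * r))
        ≡⟨ solve 4 (λ k r n Y → let nY² = n :* (Y :* Y); rY = r :* Y in
                     nY² :* nY² :* (con (fromℤ (+ 4)) :* k :* (r :* r))
                     := con (fromℤ (+ 4)) :* (k :* n) :* n :* (rY :* rY :* (Y :* Y)))
                   refl k r (fromℤ n) (fromℤ Y) ⟩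
      ⟦ cosineLawʳ ⟧ℚ (k * fromℤ n ∷ fromℤ n ∷ r * fromℤ Y ∷ fromℤ Y ∷ q * fromℤ Y ∷ [])
        ≡⟨ cong ⟦ cosineLawʳ ⟧ℚ ρ≡ ⟩
      ⟦ cosineLawʳ ⟧ℚ (Vec.map fromℤ ρ)
        ≡⟨ sym (fromℤ-⟦⟧ cosineLawʳ ρ) ⟩
      fromℤ (⟦ cosineLawʳ ⟧ℤ ρ) ∎

  cosineLaw⇒solution : ∀ e P A B C → 0 ℕ.< e → e ℕ.< P → 0 ℕ.< A → 0 ℕ.< B →
                       CosineLaw (+ e) (+ P) (+ (A ℕ.* A)) (+ (B ℕ.* B)) (+ (C ℕ.* C)) → RationalSolution
  cosineLaw⇒solution e P@(ℕ.suc _) A@(ℕ.suc _) B@(ℕ.suc _) C 0<e e<P _ _ law =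
    k , r , q , Equivalence.from equation⇔law law′ , r≢0 , 0<k , m<n⇒+m/n<1 e<P , r≢0
    where
    k = + e / P
    r = + A / B
    q = + C / B

    equation⇔law = equation⇔cosineLaw k r q (+ e) (+ P) (+ A) (+ B) (+ C) (λ ()) (λ ())
                                       (i/n*n≡i (+ e) P) (i/n*n≡i (+ A) B) (i/n*n≡i (+ C) B)

    law′ : CosineLaw (+ e) (+ P) (+ A ℤ.* + A) (+ B ℤ.* + B) (+ C ℤ.* + C)
    law′ = subst₂ (λ a b → CosineLaw (+ e) (+ P) a b (+ C ℤ.* + C)) (ℤ.pos-* A A) (ℤ.pos-* B B)
             (subst (CosineLaw (+ e) (+ P) (+ (A ℕ.* A)) (+ (B ℕ.* B))) (ℤ.pos-* C C) law)

    0<k : 0ℚ < k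
    0<k = ℚ.positive⁻¹ k {{ℚ.normalize-pos e P {{_}} {{ℕ.>-nonZero 0<e}}}}

    r≢0 : r ≢ 0ℚ
    r≢0 r≡0 = contradiction
      (trans (sym (i/n*n≡i (+ A) B)) (trans (cong (_* fromℤ (+ B)) r≡0) (ℚ.*-zeroˡ (fromℤ (+ B))))) λ ()

  solution⇒cosineLaw : RationalSolution →
                       Σ ℕ λ M → Σ ℕ λ n → Σ ℤ λ X → Σ ℤ λ Y → Σ ℤ λ Z →
                       0 ℕ.< M × M ℕ.< n × ℤ.NonZero X × ℤ.NonZero Y ×
                       CosineLaw (+ M) (+ n) (X ℤ.* X) (Y ℤ.* Y) (Z ℤ.* Z)
  solution⇒cosineLaw (k , r , q , equation , _ , 0<k , k<1 , r≢0) =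
    M , ↧ₙ k , X , Y , Z , ℤ.drop‿+<+ 0<+M , ℤ.drop‿+<+ +M<↧k , X≢0 , ℤ.i*j≢0 (↧ r) (↧ q) ,
    Equivalence.to (equation⇔cosineLaw k r q (+ M) (↧ k) X Y Z (λ ()) (λ ()) kn≡M rY≡X qY≡Z) equation
    where
    M = ℤ.∣ ↥ k ∣
    X = ↥ r ℤ.* ↧ q
    Y = ↧ r ℤ.* ↧ q
    Z = ↥ q ℤ.* ↧ r

    0<↥k : + 0 ℤ.< ↥ k
    0<↥k = subst₂ ℤ._<_ (ℤ.*-zeroˡ (↧ k)) (ℤ.*-identityʳ (↥ k)) (ℚ.drop-*<* 0<k)

    +M≡↥k : + M ≡ ↥ k
    +M≡↥k = ℤ.0≤i⇒+∣i∣≡i (ℤ.<⇒≤ 0<↥k)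

    0<+M : + 0 ℤ.< + M
    0<+M = subst (+ 0 ℤ.<_) (sym +M≡↥k) 0<↥k

    +M<↧k : + M ℤ.< ↧ k
    +M<↧k = subst₂ ℤ._<_ (trans (ℤ.*-identityʳ (↥ k)) (sym +M≡↥k)) (ℤ.*-identityˡ (↧ k)) (ℚ.drop-*<* k<1)

    X≢0 : ℤ.NonZero X
    X≢0 = ℤ.i*j≢0 (↥ r) (↧ q) {{ℤ.≢-nonZero (r≢0 ∘ ℚ.↥p≡0⇒p≡0 r)}}

    kn≡M : k * fromℤ (↧ k) ≡ fromℤ (+ M)
    kn≡M = trans (p*↧p≡↥p k) (cong fromℤ (sym +M≡↥k))

    rY≡X : r * fromℤ Y ≡ fromℤ X
    rY≡X = p*[↧p*i]≡↥p*i r (↧ q)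

    qY≡Z : q * fromℤ Y ≡ fromℤ Z
    qY≡Z = subst (λ y → q * fromℤ y ≡ fromℤ Z) (ℤ.*-comm (↧ q) (↧ r)) (p*[↧p*i]≡↥p*i q (↧ r))

open QuarticEquation

heron⇒solution : ∀ A B C Δ → 0 ℕ.< A → 0 ℕ.< B → 0 ℕ.< Δ → C ℕ.* C ℕ.≤ A ℕ.* A →
                 ℤ.+ (16 ℕ.* (Δ ℕ.* Δ)) ≡ heronProduct (A ℕ.* A) (B ℕ.* B) (C ℕ.* C) → RationalSolution
heron⇒solution A B@(ℕ.suc _) C Δ 0<A 0<B 0<Δ c≤a 16Δ²≡heron =
  let e , P , 0<e , e<P , law = heron⇒cosineLaw Δ ℕ.z<s 0<Δ c≤a 16Δ²≡heron
  in cosineLaw⇒solution e P A B C 0<e e<P 0<A 0<B law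

theorem1p1 : (Σ ℕ λ a → Σ ℕ λ b → Σ ℕ λ c →
                HeronTriangle a b c × PositiveSquare a × PositiveSquare b × PositiveSquare c)
             ⇔ (Σ ℚ λ k → Σ ℚ λ r → Σ ℚ λ q →
                Equation k r q × NonTrivial k r q × 0ℚ < k × k < 1ℚ × r ≢ 0ℚ)
theorem1p1 = mk⇔ forward backward
  where
  forward : SquareHeronTriangle → RationalSolution
  forward (_ , _ , _ , (_ , _ , _ , _ , _ , _ , Δ , 0<Δ , 16Δ²≡heron) ,
           (A , 0<A , refl) , (B , 0<B , refl) , (C , 0<C , refl))
    with ℕ.≤-total (C ℕ.* C) (A ℕ.* A)
  ... | inj₁ c≤a = heron⇒solution A B C Δ 0<A 0<B 0<Δ c≤a 16Δ²≡heron
  ... | inj₂ a≤c = heron⇒solution C B A Δ 0<C 0<B 0<Δ a≤c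
                     (trans 16Δ²≡heron (heron-swap₁₃ (ℤ.+ (A ℕ.* A)) (ℤ.+ (B ℕ.* B)) (ℤ.+ (C ℕ.* C))))

  backward : RationalSolution → SquareHeronTriangle
  backward solution =
    let M , n , X , Y , Z , 0<M , M<n , X≢0 , Y≢0 , law = solution⇒cosineLaw solution
    in cosineLaw⇒squareHeronTriangle M n X Y Z 0<M M<n X≢0 Y≢0 law
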